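{- Let $G$ be a cograph with $|G|\ge 2$, and let $0<\varepsilon\le 1$. Then there is a partition of $V(G)$ into four (possibly empty) sets $A_0,A_1,A_2,A_3$ such that: $A_0$ is $\varepsilon$-restricted; every two of $A_1,A_2,A_3$ form a pure pair; and for $1\le i\le 3$, if $A_i\ne\emptyset$, then there exists $B\subseteq V(G)\setminus A_i$ with $|B|\ge\frac{\varepsilon^2}{4}|G|$ such that $(A_i,B)$ is a pure pair.
   Context: All graphs are finite and simple; $|G|$ is the number of vertices, $G[X]$ the induced subgraph on $X$, $\overline{G}$ the complement. A cograph is a graph with no induced subgraph isomorphic to $P_4$ (the path on four vertices). For $\varepsilon>0$, a set $X\subseteq V(G)$ is $\varepsilon$-restricted if one of $G[X]$, $\overline{G}[X]$ has maximum degree at most $\varepsilon|X|$. Disjoint sets $P,Q\subseteq V(G)$ are complete if every vertex of $P$ is adjacent to every vertex of $Q$, anticomplete if there is no edge between them; $(P,Q)$ is a pure pair if $P,Q$ are disjoint and $Q$ is complete or anticomplete to $P$.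
   Formalization: The parameter ε ranges only over the rationals with $0<\varepsilon\le 1$. -}

module Defs where

open import Data.Nat using (ℕ; zero; suc)
open import Data.Bool using (Bool; true; false; not; _∧_)
open import Data.Fin using (Fin)
open import Data.Fin.Subset using (Subset; _∈_; _∉_; ∣_∣; _∩_)
open import Data.Vec using (tabulate)
open import Data.Integer using (+_)
open import Data.Rational using (ℚ; _/_; _≤_; _<_; _*_; 0ℚ; 1ℚ)
open import Data.Product using (Σ; _×_; _,_; ∃)
open import Data.Sum using (_⊎_)
open import Relation.Nullary using (¬_; does)
open import Relation.Binary.PropositionalEquality using (_≡_; _≢_)
open import Data.Fin using (_≟_)

record Graph (n : ℕ) : Set where
  field
    adj   : Fin n → Fin n → Bool
    sym   : ∀ u v → adj u v ≡ adj v u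
    irrefl : ∀ v → adj v v ≡ false
open Graph public

module _ {n : ℕ} (G : Graph n) where

  Adj : Fin n → Fin n → Set
  Adj u v = adj G u v ≡ true

  IsCograph : Set
  IsCograph = ¬ (Σ (Fin n) λ a → Σ (Fin n) λ b → Σ (Fin n) λ c → Σ (Fin n) λ d →
     (a ≢ b) × (a ≢ c) × (a ≢ d) × (b ≢ c) × (b ≢ d) × (c ≢ d) ×
     Adj a b × Adj b c × Adj c d × ¬ Adj a c × ¬ Adj a d × ¬ Adj b d)

  nbhd : Fin n → Subset n
  nbhd v = tabulate λ u → adj G v u

  coNbhd : Fin n → Subset n
  coNbhd v = tabulate λ u → not (adj G v u) ∧ not (does (u ≟ v))

  degIn : Subset n → Fin n → ℕ
  degIn X v = ∣ X ∩ nbhd v ∣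

  coDegIn : Subset n → Fin n → ℕ
  coDegIn X v = ∣ X ∩ coNbhd v ∣

ℕ→ℚ : ℕ → ℚ
ℕ→ℚ k = + k / 1

module _ {n : ℕ} (G : Graph n) where

  Restricted : ℚ → Subset n → Set
  Restricted ε X =
    (∀ v → v ∈ X → ℕ→ℚ (degIn G X v) ≤ ε * ℕ→ℚ ∣ X ∣) ⊎
    (∀ v → v ∈ X → ℕ→ℚ (coDegIn G X v) ≤ ε * ℕ→ℚ ∣ X ∣)

  Disjoint : Subset n → Subset n → Set
  Disjoint P Q = ∀ v → v ∈ P → v ∉ Q

  Complete : Subset n → Subset n → Set
  Complete P Q = ∀ p q → p ∈ P → q ∈ Q → Adj G p q

  Anticomplete : Subset n → Subset n → Set
  Anticomplete P Q = ∀ p q → p ∈ P → q ∈ Q → ¬ Adj G p q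

  PurePair : Subset n → Subset n → Set
  PurePair P Q = Disjoint P Q × (Complete P Q ⊎ Anticomplete P Q)

  NonEmpty : Subset n → Set
  NonEmpty X = ∃ λ v → v ∈ X

block : {n : ℕ} → (Fin n → Fin 4) → Fin 4 → Subset n
block part i = tabulate λ v → does (part v ≟ i)

-- Every induced subgraph of a cograph with at least two vertices splits into two nonempty
-- parts X, Y forming a pure pair. Starting from S = V(G), split S, keep the larger part X
-- and move the smaller part Y to P (complete to the new S) or to Q (anticomplete to it),
-- as long as t = |P| + |Q| stays below ε²n/2. At the end |S| > n/2, and since moving Y
-- would push t past ε²n/2, one of the two sides homogeneous to X has at least ε²n/4
-- vertices. Following the decomposition of G[S] down to sets of at most t + 1 vertices
-- gives Z₁, Z₂ ⊆ S of maximum degree at most t in G and in its complement with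
-- t|S| ≤ |Z₁||Z₂|, so one of them has at least t/ε vertices; adding Q (resp. P) to it
-- gives the ε-restricted A₀. The other one of P, Q is A₁, and what is left of Y and of X
-- forms A₂ and A₃, with pure partners S, X and the large side of X.

module Submission where

open import Defs hiding (sym)

module Cographs where

  open import Data.Bool using (Bool; true; false; not; _∧_)
  open import Data.Bool.Properties using (¬-not; ∧-zeroʳ)
  open import Data.Empty using (⊥-elim)
  open import Data.Fin using (Fin; zero; suc; _≟_)
  open import Data.Fin.Subset
    using (Subset; inside; outside; _∈_; _∉_; _⊆_; _∩_; _∪_; _─_; _-_; ∁; ⁅_⁆; ⊤; ⊥; ∣_∣; Nonempty)
  open import Data.Fin.Subset.Properties
  import Data.Integer as ℤ
  open import Data.Integer.Properties using (pos-*; drop‿+≤+; drop‿+<+)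
  open import Data.Nat using (ℕ; zero; suc; _+_; _*_; _≤_; _<_; _⊓_; _≤?_; _<?_; z≤n; s≤s; s≤s⁻¹; s<s⁻¹)
  open import Data.Nat.Induction using (<-wellFounded)
  open import Data.Nat.Properties hiding (_≟_)
  open import Algebra.Properties.CommutativeSemigroup +-commutativeSemigroup using (xy∙z≈xz∙y)
  open import Data.Nat.Tactic.RingSolver using (solve-∀)
  open import Data.Product using (Σ; ∃-syntax; _×_; _,_; proj₁; proj₂)
  import Data.Rational as ℚ
  open import Data.Rational using (ℚ; mkℚ; toℚᵘ; 0ℚ; 1ℚ)
  open import Data.Rational.Properties using (toℚᵘ-homo-*; toℚᵘ-fromℚᵘ; toℚᵘ-cancel-≤; toℚᵘ-mono-≤; toℚᵘ-mono-<)
  open import Data.Rational.Unnormalised using (mkℚᵘ; *≤*; *<*; _≃_)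
  open import Data.Rational.Unnormalised.Properties
    using (≃-refl; ≃-sym; ≃-trans; ≃-reflexive; ≤-respˡ-≃; ≤-respʳ-≃; *-cong)
  open import Data.Sum using (_⊎_; inj₁; inj₂; [_,_]′)
  open import Data.Vec using ([]; _∷_; here; there; tabulate)
  open import Data.Vec.Properties using ([]=⇒lookup; lookup⇒[]=; lookup∘tabulate)
  open import Function using (_∘_; id)
  open import Induction.WellFounded using (Acc; acc)
  open import Relation.Nullary using (¬_; Dec; yes; no; does)
  open import Relation.Nullary.Decidable using (dec-true; dec-false; decidable-stable)
  open import Relation.Binary.PropositionalEquality
    using (_≡_; _≢_; refl; sym; trans; cong; cong₂; subst; subst₂; module ≡-Reasoning)

  private
    variable
      n : ℕ

  ∈-tabulate⁻ : ∀ {f : Fin n → Bool} {x} → x ∈ tabulate f → f x ≡ true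
  ∈-tabulate⁻ {f = f} {x} x∈ = trans (sym (lookup∘tabulate f x)) ([]=⇒lookup x∈)

  ∈-tabulate⁺ : ∀ {f : Fin n → Bool} {x} → f x ≡ true → x ∈ tabulate f
  ∈-tabulate⁺ {f = f} {x} fx = lookup⇒[]= x (tabulate f) (trans (lookup∘tabulate f x) fx)

  ∣p∪q∣≡∣p∣+∣q∣ : {p q : Subset n} → (∀ x → x ∈ p → x ∉ q) → ∣ p ∪ q ∣ ≡ ∣ p ∣ + ∣ q ∣
  ∣p∪q∣≡∣p∣+∣q∣ {p = []}          {[]}          _ = refl
  ∣p∪q∣≡∣p∣+∣q∣ {p = inside  ∷ p} {inside  ∷ q} d = ⊥-elim (d zero here here)
  ∣p∪q∣≡∣p∣+∣q∣ {p = inside  ∷ p} {outside ∷ q} d =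
    cong suc (∣p∪q∣≡∣p∣+∣q∣ λ x x∈p x∈q → d (suc x) (there x∈p) (there x∈q))
  ∣p∪q∣≡∣p∣+∣q∣ {p = outside ∷ p} {inside  ∷ q} d =
    trans (cong suc (∣p∪q∣≡∣p∣+∣q∣ λ x x∈p x∈q → d (suc x) (there x∈p) (there x∈q)))
          (sym (+-suc ∣ p ∣ ∣ q ∣))
  ∣p∪q∣≡∣p∣+∣q∣ {p = outside ∷ p} {outside ∷ q} d =
    ∣p∪q∣≡∣p∣+∣q∣ λ x x∈p x∈q → d (suc x) (there x∈p) (there x∈q)

  ⊆-with-size : ∀ (p : Subset n) {k} → k ≤ ∣ p ∣ → ∃[ q ] q ⊆ p × ∣ q ∣ ≡ k
  ⊆-with-size {n} p {zero} _ = ⊥ , ⊥⊆ , ∣⊥∣≡0 n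
  ⊆-with-size (inside ∷ p) {suc k} (s≤s k≤∣p∣) =
    let q , q⊆p , ∣q∣≡k = ⊆-with-size p k≤∣p∣ in inside ∷ q , in⊆in q⊆p , cong suc ∣q∣≡k
  ⊆-with-size (outside ∷ p) {suc k} k≤∣p∣ =
    let q , q⊆p , ∣q∣≡k = ⊆-with-size p k≤∣p∣ in outside ∷ q , out⊆ q⊆p , ∣q∣≡k

  x∈p⇒0<∣p∣ : ∀ {p : Subset n} {x} → x ∈ p → 0 < ∣ p ∣
  x∈p⇒0<∣p∣ x∈p = ≤-<-trans z≤n (x∈p⇒∣p-x∣<∣p∣ x∈p)

  0<∣p∣⇒nonempty : ∀ {p : Subset n} → 0 < ∣ p ∣ → Nonempty p
  0<∣p∣⇒nonempty {n} {p} 0<∣p∣ with nonempty? p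
  ... | yes ne = ne
  ... | no ¬ne = ⊥-elim (<-irrefl (sym (∣⊥∣≡0 n)) (subst (λ q → 0 < ∣ q ∣) (Empty-unique ¬ne) 0<∣p∣))

  x∈p─q⇒x∉q : ∀ {p q : Subset n} {x} → x ∈ p ─ q → x ∉ q
  x∈p─q⇒x∉q {p = inside ∷ p} {outside ∷ q} here        ()
  x∈p─q⇒x∉q {p = _      ∷ p} {_       ∷ q} (there x∈) (there x∈q) = x∈p─q⇒x∉q {p = p} {q} x∈ x∈q

  p≡⁅x⁆∪p-x : ∀ {p : Subset n} {x} → x ∈ p → p ≡ ⁅ x ⁆ ∪ (p - x)
  p≡⁅x⁆∪p-x {p = p} {x} x∈p = ⊆-antisym into back
    where
    into : p ⊆ ⁅ x ⁆ ∪ (p - x)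
    into {y} y∈p with y ≟ x
    ... | yes refl = p⊆p∪q (p - x) (x∈⁅x⁆ x)
    ... | no y≢x  = q⊆p∪q ⁅ x ⁆ (p - x) (x∈p∧x≢y⇒x∈p-y y∈p y≢x)
    back : ⁅ x ⁆ ∪ (p - x) ⊆ p
    back {y} y∈ with x∈p∪q⁻ ⁅ x ⁆ (p - x) y∈
    ... | inj₁ y∈⁅x⁆ = subst (_∈ p) (sym (x∈⁅y⁆⇒x≡y x y∈⁅x⁆)) x∈p
    ... | inj₂ y∈p-x = p─q⊆p p ⁅ x ⁆ y∈p-x

  ∣p∣≡1+∣p-x∣ : ∀ {p : Subset n} {x} → x ∈ p → ∣ p ∣ ≡ suc ∣ p - x ∣
  ∣p∣≡1+∣p-x∣ {p = p} {x} x∈p = trans (cong ∣_∣ (p≡⁅x⁆∪p-x x∈p))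
    (trans (∣p∪q∣≡∣p∣+∣q∣ {p = ⁅ x ⁆} λ _ y∈⁅x⁆ y∈p-x → x∈p─q⇒x∉q {p = p} y∈p-x y∈⁅x⁆)
           (cong (_+ ∣ p - x ∣) (∣⁅x⁆∣≡1 x)))

  distinct∈p⇒1<∣p∣ : ∀ {p : Subset n} {x y} → x ∈ p → y ∈ p → x ≢ y → 1 < ∣ p ∣
  distinct∈p⇒1<∣p∣ x∈p y∈p x≢y =
    <-≤-trans (s≤s (x∈p⇒0<∣p∣ (x∈p∧x≢y⇒x∈p-y y∈p (x≢y ∘ sym)))) (x∈p⇒∣p-x∣<∣p∣ x∈p)

  -- Cographs and complements

  module _ (G : Graph n) where

    Adj-sym : ∀ {u v} → Adj G u v → Adj G v u
    Adj-sym {u} {v} uv = trans (Graph.sym G v u) uv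

    Adj⇒≢ : ∀ {u v} → Adj G u v → u ≢ v
    Adj⇒≢ {u} uu refl with () ← trans (sym uu) (irrefl G u)

    Adj? : ∀ u v → Dec (Adj G u v)
    Adj? u v = adj G u v Data.Bool.≟ true

    ∈-nbhd⁻ : ∀ {u v} → u ∈ nbhd G v → Adj G v u
    ∈-nbhd⁻ = ∈-tabulate⁻

    ∈-nbhd⁺ : ∀ {u v} → Adj G v u → u ∈ nbhd G v
    ∈-nbhd⁺ = ∈-tabulate⁺

    ∈∩nbhd⁻ : ∀ {T u v} → u ∈ T ∩ nbhd G v → u ∈ T × Adj G v u
    ∈∩nbhd⁻ {T} u∈ = let u∈T , u∈N = x∈p∩q⁻ T _ u∈ in u∈T , ∈-nbhd⁻ u∈N

    ∈∩nbhd⁺ : ∀ {T u v} → u ∈ T → Adj G v u → u ∈ T ∩ nbhd G v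
    ∈∩nbhd⁺ u∈T vu = x∈p∩q⁺ (u∈T , ∈-nbhd⁺ vu)

    ∈∩∁nbhd⁻ : ∀ {T u v} → u ∈ T ∩ ∁ (nbhd G v) → u ∈ T × ¬ Adj G v u
    ∈∩∁nbhd⁻ {T} u∈ = let u∈T , u∈∁N = x∈p∩q⁻ T _ u∈ in u∈T , x∈∁p⇒x∉p u∈∁N ∘ ∈-nbhd⁺

    ∈∩∁nbhd⁺ : ∀ {T u v} → u ∈ T → ¬ Adj G v u → u ∈ T ∩ ∁ (nbhd G v)
    ∈∩∁nbhd⁺ u∈T ¬vu = x∈p∩q⁺ (u∈T , x∉p⇒x∈∁p (¬vu ∘ ∈-nbhd⁻))

    noInducedP4 : IsCograph G → ∀ {a b c d} →
      Adj G a b → Adj G b c → Adj G c d → ¬ Adj G a c → ¬ Adj G a d → ¬ Adj G b d → Data.Empty.⊥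
    noInducedP4 cog {a} {b} {c} {d} ab bc cd ¬ac ¬ad ¬bd =
      cog (a , b , c , d , Adj⇒≢ ab , a≢c , a≢d , Adj⇒≢ bc , b≢d , Adj⇒≢ cd , ab , bc , cd , ¬ac , ¬ad , ¬bd)
      where
      a≢c : a ≢ c
      a≢c refl = ¬ad cd
      a≢d : a ≢ d
      a≢d refl = ¬ac (Adj-sym cd)
      b≢d : b ≢ d
      b≢d refl = ¬ad ab

  -- Chosen so that  nbhd (complement G) v  is literally  coNbhd G v,  hence
  -- degIn (complement G) is coDegIn G by definition.
  complement : Graph n → Graph n
  complement G = record
    { adj    = λ u v → not (adj G u v) ∧ not (does (v ≟ u))
    ; sym    = λ u v → cong₂ (λ b c → not b ∧ not c) (Graph.sym G u v) (does-≟-sym v u)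
    ; irrefl = λ v → trans (cong (λ b → not (adj G v v) ∧ not b) (dec-true (v ≟ v) refl)) (∧-zeroʳ _)
    }
    where
    does-≟-sym : ∀ (u v : Fin _) → does (u ≟ v) ≡ does (v ≟ u)
    does-≟-sym u v with u ≟ v | v ≟ u
    ... | yes _   | yes _   = refl
    ... | no _    | no _    = refl
    ... | yes u≡v | no v≢u  = ⊥-elim (v≢u (sym u≡v))
    ... | no u≢v  | yes v≡u = ⊥-elim (u≢v (sym v≡u))

  module _ (G : Graph n) where

    complement-Adj⁺ : ∀ {u v} → u ≢ v → ¬ Adj G u v → Adj (complement G) u v
    complement-Adj⁺ {u} {v} u≢v ¬uv
      rewrite dec-false (v ≟ u) (u≢v ∘ sym) | ¬-not ¬uv = refl

    complement-Adj⁻ : ∀ {u v} → Adj (complement G) u v → ¬ Adj G u v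
    complement-Adj⁻ {u} {v} uv′ uv rewrite uv with () ← uv′

    complement-¬Adj⁻ : ∀ {u v} → u ≢ v → ¬ Adj (complement G) u v → Adj G u v
    complement-¬Adj⁻ {u} {v} u≢v ¬uv′ with Adj? G u v
    ... | yes uv = uv
    ... | no ¬uv = ⊥-elim (¬uv′ (complement-Adj⁺ u≢v ¬uv))

    complement-isCograph : IsCograph G → IsCograph (complement G)
    complement-isCograph cog (a , b , c , d , _ , a≢c , a≢d , _ , b≢d , _ , ab , bc , cd , ¬ac , ¬ad , ¬bd) =
      noInducedP4 G cog
        (Adj-sym G (complement-¬Adj⁻ a≢c ¬ac)) (complement-¬Adj⁻ a≢d ¬ad) (Adj-sym G (complement-¬Adj⁻ b≢d ¬bd))
        (complement-Adj⁻ cd) (complement-Adj⁻ bc ∘ Adj-sym G) (complement-Adj⁻ ab)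

  -- Pure splits

  Pure : Graph n → Subset n → Subset n → Set
  Pure G A B = Complete G A B ⊎ Anticomplete G A B

  module _ (G : Graph n) where

    Anticomplete-sym : ∀ {A B} → Anticomplete G A B → Anticomplete G B A
    Anticomplete-sym a p q p∈ q∈ = a q p q∈ p∈ ∘ Adj-sym G

    Pure-sym : ∀ {A B} → Pure G A B → Pure G B A
    Pure-sym (inj₁ c) = inj₁ λ p q p∈ q∈ → Adj-sym G (c q p q∈ p∈)
    Pure-sym (inj₂ a) = inj₂ (Anticomplete-sym a)

    Pure-mono : ∀ {A A′ B B′} → A′ ⊆ A → B′ ⊆ B → Pure G A B → Pure G A′ B′
    Pure-mono A′⊆A B′⊆B (inj₁ c) = inj₁ λ p q p∈ q∈ → c p q (A′⊆A p∈) (B′⊆B q∈)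
    Pure-mono A′⊆A B′⊆B (inj₂ a) = inj₂ λ p q p∈ q∈ → a p q (A′⊆A p∈) (B′⊆B q∈)

    Disjoint-sym : ∀ {A B} → Disjoint G A B → Disjoint G B A
    Disjoint-sym d x x∈B x∈A = d x x∈A x∈B

    Disjoint⇒≢ : ∀ {A B p q} → Disjoint G A B → p ∈ A → q ∈ B → p ≢ q
    Disjoint⇒≢ d p∈A q∈B refl = d _ p∈A q∈B

    Complete⇒complement-Anticomplete : ∀ {A B} → Complete G A B → Anticomplete (complement G) A B
    Complete⇒complement-Anticomplete c p q p∈ q∈ pq′ = complement-Adj⁻ G pq′ (c p q p∈ q∈)

    Pure-complement : ∀ {A B} → Disjoint G A B → Pure G A B → Pure (complement G) A B
    Pure-complement d (inj₁ c) = inj₂ (Complete⇒complement-Anticomplete c)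
    Pure-complement d (inj₂ a) = inj₁ λ p q p∈ q∈ → complement-Adj⁺ G (Disjoint⇒≢ d p∈ q∈) (a p q p∈ q∈)

    Pure-uncomplement : ∀ {A B} → Disjoint G A B → Pure (complement G) A B → Pure G A B
    Pure-uncomplement d (inj₁ c) = inj₂ λ p q p∈ q∈ pq → complement-Adj⁻ G (c p q p∈ q∈) pq
    Pure-uncomplement d (inj₂ a) = inj₁ λ p q p∈ q∈ → complement-¬Adj⁻ G (Disjoint⇒≢ d p∈ q∈) (a p q p∈ q∈)

  record PureSplit (G : Graph n) (S : Subset n) : Set where
    field
      X Y        : Subset n
      S≡X∪Y      : S ≡ X ∪ Y
      disjoint   : Disjoint G X Y
      X-nonempty : Nonempty X
      Y-nonempty : Nonempty Y
      pure       : Pure G X Y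

    X⊆S : X ⊆ S
    X⊆S x∈X = subst (_ ∈_) (sym S≡X∪Y) (p⊆p∪q Y x∈X)

    Y⊆S : Y ⊆ S
    Y⊆S y∈Y = subst (_ ∈_) (sym S≡X∪Y) (q⊆p∪q X Y y∈Y)

    size : ∣ S ∣ ≡ ∣ X ∣ + ∣ Y ∣
    size = trans (cong ∣_∣ S≡X∪Y) (∣p∪q∣≡∣p∣+∣q∣ disjoint)

    ∣X∣<∣S∣ : ∣ X ∣ < ∣ S ∣
    ∣X∣<∣S∣ = subst (∣ X ∣ <_) (sym size) (m<m+n ∣ X ∣ (x∈p⇒0<∣p∣ (proj₂ Y-nonempty)))

    ∣Y∣<∣S∣ : ∣ Y ∣ < ∣ S ∣
    ∣Y∣<∣S∣ = subst (∣ Y ∣ <_) (sym size) (m<n+m ∣ Y ∣ (x∈p⇒0<∣p∣ (proj₂ X-nonempty)))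

    swap : PureSplit G S
    swap = record
      { X = Y ; Y = X ; S≡X∪Y = trans S≡X∪Y (∪-comm X Y) ; disjoint = Disjoint-sym G disjoint
      ; X-nonempty = Y-nonempty ; Y-nonempty = X-nonempty ; pure = Pure-sym G pure }

  orient : ∀ {G : Graph n} {S} → PureSplit G S → Σ (PureSplit G S) λ sp → ∣ PureSplit.Y sp ∣ ≤ ∣ PureSplit.X sp ∣
  orient sp with ≤-total (∣ PureSplit.Y sp ∣) (∣ PureSplit.X sp ∣)
  ... | inj₁ ∣Y∣≤∣X∣ = sp , ∣Y∣≤∣X∣
  ... | inj₂ ∣X∣≤∣Y∣ = PureSplit.swap sp , ∣X∣≤∣Y∣

  module _ {G : Graph n} {S : Subset n} where

    PureSplit-complement : PureSplit G S → PureSplit (complement G) S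
    PureSplit-complement sp = record
      { X = X ; Y = Y ; S≡X∪Y = S≡X∪Y ; disjoint = disjoint ; X-nonempty = X-nonempty ; Y-nonempty = Y-nonempty
      ; pure = Pure-complement G disjoint pure }
      where open PureSplit sp

    PureSplit-uncomplement : PureSplit (complement G) S → PureSplit G S
    PureSplit-uncomplement sp = record
      { X = X ; Y = Y ; S≡X∪Y = S≡X∪Y ; disjoint = disjoint ; X-nonempty = X-nonempty ; Y-nonempty = Y-nonempty
      ; pure = Pure-uncomplement G disjoint pure }
      where open PureSplit sp

  ∈⁅x⁆∪⁻ : ∀ {x y} {p : Subset n} → y ∈ ⁅ x ⁆ ∪ p → y ≡ x ⊎ y ∈ p
  ∈⁅x⁆∪⁻ {x = x} {p = p} y∈ with x∈p∪q⁻ ⁅ x ⁆ p y∈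
  ... | inj₁ y∈⁅x⁆ = inj₁ (x∈⁅y⁆⇒x≡y x y∈⁅x⁆)
  ... | inj₂ y∈p   = inj₂ y∈p

  x∈⁅x⁆∪p : ∀ (x : Fin n) (p : Subset n) → x ∈ ⁅ x ⁆ ∪ p
  x∈⁅x⁆∪p x p = p⊆p∪q p (x∈⁅x⁆ x)

  module _ (G : Graph n) (cog : IsCograph G) {T : Subset n} {v m : Fin n}
           (sp : PureSplit G T) (anti : Anticomplete G (PureSplit.X sp) (PureSplit.Y sp))
           (v∉T : v ∉ T) (m∈T : m ∈ T) (¬vm : ¬ Adj G v m) where

    open PureSplit sp

    private
      ⁅v⁆∪T≡[⁅v⁆∪X]∪Y : ⁅ v ⁆ ∪ T ≡ (⁅ v ⁆ ∪ X) ∪ Y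
      ⁅v⁆∪T≡[⁅v⁆∪X]∪Y = trans (cong (⁅ v ⁆ ∪_) S≡X∪Y) (sym (∪-assoc ⁅ v ⁆ X Y))

      N M : Subset n
      N = T ∩ nbhd G v
      M = T ∩ ∁ (nbhd G v)

      X⊎Y : ∀ {u} → u ∈ T → u ∈ X ⊎ u ∈ Y
      X⊎Y u∈T = x∈p∪q⁻ X Y (subst (_ ∈_) S≡X∪Y u∈T)

      -- p – q – v – w would be an induced P4.
      no-path-through-v : ∀ {p q w} → Adj G p q → ¬ Adj G v p → Adj G v q → Adj G v w →
                          ¬ Adj G p w → ¬ Adj G q w → Data.Empty.⊥
      no-path-through-v pq ¬vp vq vw ¬pw ¬qw =
        noInducedP4 G cog pq (Adj-sym G vq) vw (¬vp ∘ Adj-sym G) ¬pw ¬qw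

      add-to-Y : ¬ Nonempty (X ∩ nbhd G v) → PureSplit G (⁅ v ⁆ ∪ T)
      add-to-Y v≁X = record
        { X = X ; Y = ⁅ v ⁆ ∪ Y
        ; S≡X∪Y = trans ⁅v⁆∪T≡[⁅v⁆∪X]∪Y (trans (cong (_∪ Y) (∪-comm ⁅ v ⁆ X)) (∪-assoc X ⁅ v ⁆ Y))
        ; disjoint = λ x x∈X x∈ → [ (λ { refl → v∉T (X⊆S x∈X) }) , disjoint x x∈X ]′ (∈⁅x⁆∪⁻ x∈)
        ; X-nonempty = X-nonempty ; Y-nonempty = v , x∈⁅x⁆∪p v Y
        ; pure = inj₂ λ p q p∈X q∈ → [ (λ { refl pv → v≁X (p , ∈∩nbhd⁺ G p∈X (Adj-sym G pv)) })
                                       , anti p q p∈X ]′ (∈⁅x⁆∪⁻ q∈)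
        }

      add-to-X : ¬ Nonempty (Y ∩ nbhd G v) → PureSplit G (⁅ v ⁆ ∪ T)
      add-to-X v≁Y = record
        { X = ⁅ v ⁆ ∪ X ; Y = Y
        ; S≡X∪Y = ⁅v⁆∪T≡[⁅v⁆∪X]∪Y
        ; disjoint = λ y y∈ y∈Y → [ (λ { refl → v∉T (Y⊆S y∈Y) }) , (λ y∈X → disjoint y y∈X y∈Y) ]′
                                    (∈⁅x⁆∪⁻ y∈)
        ; X-nonempty = v , x∈⁅x⁆∪p v X ; Y-nonempty = Y-nonempty
        ; pure = inj₂ λ p q p∈ q∈Y → [ (λ { refl vq → v≁Y (q , ∈∩nbhd⁺ G q∈Y vq) })
                                       , (λ p∈X → anti p q p∈X q∈Y) ]′ (∈⁅x⁆∪⁻ p∈)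
        }

      -- With neighbours of v on both sides, the non-neighbours of v are anticomplete
      -- to v and its neighbours.
      split-by-nbhd : ∀ {x₀ y₀} → x₀ ∈ X × Adj G v x₀ → y₀ ∈ Y × Adj G v y₀ → PureSplit G (⁅ v ⁆ ∪ T)
      split-by-nbhd {x₀} {y₀} (x₀∈X , vx₀) (y₀∈Y , vy₀) = record
        { X = M ; Y = ⁅ v ⁆ ∪ N
        ; S≡X∪Y = ⊆-antisym into back
        ; disjoint = λ u u∈M u∈ → [ (λ { refl → v∉T (proj₁ (∈∩∁nbhd⁻ G u∈M)) })
                                    , (λ u∈N → proj₂ (∈∩∁nbhd⁻ G u∈M) (proj₂ (∈∩nbhd⁻ G u∈N))) ]′ (∈⁅x⁆∪⁻ u∈)
        ; X-nonempty = m , ∈∩∁nbhd⁺ G m∈T ¬vm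
        ; Y-nonempty = v , x∈⁅x⁆∪p v N
        ; pure = inj₂ M-anticomplete
        }
        where
        into : ⁅ v ⁆ ∪ T ⊆ M ∪ (⁅ v ⁆ ∪ N)
        into {u} u∈ with ∈⁅x⁆∪⁻ u∈
        ... | inj₁ refl = q⊆p∪q M _ (x∈⁅x⁆∪p v N)
        ... | inj₂ u∈T with Adj? G v u
        ...   | yes vu = q⊆p∪q M _ (q⊆p∪q ⁅ v ⁆ N (∈∩nbhd⁺ G u∈T vu))
        ...   | no ¬vu = p⊆p∪q _ (∈∩∁nbhd⁺ G u∈T ¬vu)

        back : M ∪ (⁅ v ⁆ ∪ N) ⊆ ⁅ v ⁆ ∪ T
        back {u} u∈ with x∈p∪q⁻ M _ u∈
        ... | inj₁ u∈M = q⊆p∪q ⁅ v ⁆ T (proj₁ (∈∩∁nbhd⁻ G u∈M))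
        ... | inj₂ u∈ with ∈⁅x⁆∪⁻ u∈
        ...   | inj₁ refl = x∈⁅x⁆∪p v T
        ...   | inj₂ u∈N  = q⊆p∪q ⁅ v ⁆ T (proj₁ (∈∩nbhd⁻ G u∈N))

        M-anticomplete : Anticomplete G M (⁅ v ⁆ ∪ N)
        M-anticomplete p q p∈M q∈ pq with ∈∩∁nbhd⁻ G p∈M | ∈⁅x⁆∪⁻ q∈
        ... | _ , ¬vp | inj₁ refl = ¬vp (Adj-sym G pq)
        ... | p∈T , ¬vp | inj₂ q∈N with ∈∩nbhd⁻ G q∈N
        ...   | q∈T , vq with X⊎Y p∈T | X⊎Y q∈T
        ...     | inj₁ p∈X | inj₂ q∈Y = anti p q p∈X q∈Y pq
        ...     | inj₂ p∈Y | inj₁ q∈X = anti q p q∈X p∈Y (Adj-sym G pq)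
        ...     | inj₁ p∈X | inj₁ q∈X = no-path-through-v pq ¬vp vq vy₀ (anti p y₀ p∈X y₀∈Y) (anti q y₀ q∈X y₀∈Y)
        ...     | inj₂ p∈Y | inj₂ q∈Y = no-path-through-v pq ¬vp vq vx₀
                                          (anti x₀ p x₀∈X p∈Y ∘ Adj-sym G) (anti x₀ q x₀∈X q∈Y ∘ Adj-sym G)

    add-vertex : PureSplit G (⁅ v ⁆ ∪ T)
    add-vertex with nonempty? (X ∩ nbhd G v) | nonempty? (Y ∩ nbhd G v)
    ... | no v≁X         | _              = add-to-Y v≁X
    ... | yes _          | no v≁Y         = add-to-X v≁Y
    ... | yes (_ , x₀∈) | yes (_ , y₀∈) = split-by-nbhd (∈∩nbhd⁻ G x₀∈) (∈∩nbhd⁻ G y₀∈)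

  module _ (G : Graph n) (cog : IsCograph G) where

    private
      split-off : ∀ {v T} → v ∉ T → Nonempty T →
                  (∀ q → q ∈ T → Adj G v q) ⊎ (∀ q → q ∈ T → ¬ Adj G v q) → PureSplit G (⁅ v ⁆ ∪ T)
      split-off {v} {T} v∉T T≠∅ v-pure = record
        { X = ⁅ v ⁆ ; Y = T ; S≡X∪Y = refl
        ; disjoint = λ { u u∈⁅v⁆ u∈T → v∉T (subst (_∈ T) (x∈⁅y⁆⇒x≡y v u∈⁅v⁆) u∈T) }
        ; X-nonempty = v , x∈⁅x⁆ v ; Y-nonempty = T≠∅
        ; pure = Data.Sum.map (λ c p q p∈ → subst (λ p → q ∈ T → Adj G p q) (sym (x∈⁅y⁆⇒x≡y v p∈)) (c q))
                              (λ a p q p∈ → subst (λ p → q ∈ T → ¬ Adj G p q) (sym (x∈⁅y⁆⇒x≡y v p∈)) (a q))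
                              v-pure }

      split-⁅v⁆∪ : ∀ {v T} → v ∉ T → Nonempty T → (1 < ∣ T ∣ → PureSplit G T) → PureSplit G (⁅ v ⁆ ∪ T)
      split-⁅v⁆∪ {v} {T} v∉T T≠∅ split-T with nonempty? (T ∩ ∁ (nbhd G v)) | nonempty? (T ∩ nbhd G v)
      ... | no v-complete | _ =
        split-off v∉T T≠∅ (inj₁ λ q q∈T → decidable-stable (Adj? G v q) (λ ¬vq → v-complete (q , ∈∩∁nbhd⁺ G q∈T ¬vq)))
      ... | yes _ | no v-anticomplete = split-off v∉T T≠∅ (inj₂ λ q q∈T vq → v-anticomplete (q , ∈∩nbhd⁺ G q∈T vq))
      ... | yes (m , m∈) | yes (u , u∈) with ∈∩∁nbhd⁻ G m∈ | ∈∩nbhd⁻ G u∈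
      ...   | m∈T , ¬vm | u∈T , vu with split-T (distinct∈p⇒1<∣p∣ m∈T u∈T λ { refl → ¬vm vu })
      ...     | sp with PureSplit.pure sp
      ...       | inj₂ anti = add-vertex G cog sp anti v∉T m∈T ¬vm
      ...       | inj₁ comp = PureSplit-uncomplement (add-vertex (complement G) (complement-isCograph G cog)
                                (PureSplit-complement sp) (Complete⇒complement-Anticomplete G comp)
                                v∉T u∈T (λ vu′ → complement-Adj⁻ G vu′ vu))

    cograph-split : ∀ {S} → 1 < ∣ S ∣ → PureSplit G S
    cograph-split {S} = go S (<-wellFounded ∣ S ∣)
      where
      go : ∀ S → Acc _<_ ∣ S ∣ → 1 < ∣ S ∣ → PureSplit G S
      go S (acc rec) 1<∣S∣ with 0<∣p∣⇒nonempty (<-trans (s≤s z≤n) 1<∣S∣)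
      ... | v , v∈S = subst (PureSplit G) (sym (p≡⁅x⁆∪p-x v∈S))
        (split-⁅v⁆∪ (λ v∈S-v → x∈p─q⇒x∉q {p = S} v∈S-v (x∈⁅x⁆ v))
                    (0<∣p∣⇒nonempty (s<s⁻¹ (subst (1 <_) (∣p∣≡1+∣p-x∣ v∈S) 1<∣S∣)))
                    (go (S - v) (rec (subst (∣ S - v ∣ <_) (sym (∣p∣≡1+∣p-x∣ v∈S)) ≤-refl))))

  -- Sparse subsets

  Sparse : Graph n → ℕ → Subset n → Set
  Sparse G s Z = ∀ v → v ∈ Z → degIn G Z v ≤ s

  module _ (G : Graph n) where

    degIn-≤ : ∀ {A B v} → (∀ {u} → u ∈ A → u ∈ B ⊎ ¬ Adj G v u) → degIn G A v ≤ degIn G B v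
    degIn-≤ {A} A⊆B∪non-nbhd = p⊆q⇒∣p∣≤∣q∣ λ u∈ →
      let u∈A , u∈N = x∈p∩q⁻ A _ u∈
      in x∈p∩q⁺ ([ id , (λ ¬vu → ⊥-elim (¬vu (∈-nbhd⁻ G u∈N))) ]′ (A⊆B∪non-nbhd u∈A) , u∈N)

    small⇒Sparse : ∀ {s Z} → ∣ Z ∣ ≤ suc s → Sparse G s Z
    small⇒Sparse {s} {Z} ∣Z∣≤1+s v v∈Z =
      s≤s⁻¹ (≤-trans (s≤s deg≤) (≤-trans (≤-reflexive (sym (∣p∣≡1+∣p-x∣ v∈Z))) ∣Z∣≤1+s))
      where
      deg≤ : degIn G Z v ≤ ∣ Z - v ∣
      deg≤ = p⊆q⇒∣p∣≤∣q∣ λ u∈ →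
        let u∈Z , u∈N = x∈p∩q⁻ Z _ u∈ in x∈p∧x≢y⇒x∈p-y u∈Z (Adj⇒≢ G (Adj-sym G (∈-nbhd⁻ G u∈N)))

    Sparse-∪ : ∀ {s X Y Z₁ Z₂} → Anticomplete G X Y → Z₁ ⊆ X → Z₂ ⊆ Y →
               Sparse G s Z₁ → Sparse G s Z₂ → Sparse G s (Z₁ ∪ Z₂)
    Sparse-∪ {Z₁ = Z₁} {Z₂} anti Z₁⊆X Z₂⊆Y sparse₁ sparse₂ v v∈ with x∈p∪q⁻ Z₁ Z₂ v∈
    ... | inj₁ v∈Z₁ =
      ≤-trans (degIn-≤ λ u∈ → Data.Sum.map₂ (λ u∈Z₂ → anti v _ (Z₁⊆X v∈Z₁) (Z₂⊆Y u∈Z₂)) (x∈p∪q⁻ Z₁ Z₂ u∈))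
              (sparse₁ v v∈Z₁)
    ... | inj₂ v∈Z₂ =
      ≤-trans (degIn-≤ λ u∈ → Data.Sum.swap (Data.Sum.map₁ (λ u∈Z₁ → anti _ v (Z₁⊆X u∈Z₁) (Z₂⊆Y v∈Z₂) ∘ Adj-sym G)
                                                             (x∈p∪q⁻ Z₁ Z₂ u∈)))
              (sparse₂ v v∈Z₂)

  ⊓-subadditive : ∀ s a b → s ⊓ (a + b) ≤ s ⊓ a + s ⊓ b
  ⊓-subadditive s a b with ≤-total s a | ≤-total s b
  ... | inj₁ s≤a | _ =
    ≤-trans (m⊓n≤m s (a + b)) (≤-trans (≤-reflexive (sym (m≤n⇒m⊓n≡m s≤a))) (m≤m+n (s ⊓ a) (s ⊓ b)))
  ... | inj₂ _   | inj₁ s≤b =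
    ≤-trans (m⊓n≤m s (a + b)) (≤-trans (≤-reflexive (sym (m≤n⇒m⊓n≡m s≤b))) (m≤n+m (s ⊓ b) (s ⊓ a)))
  ... | inj₂ a≤s | inj₂ b≤s =
    ≤-trans (m⊓n≤n s (a + b)) (≤-reflexive (sym (cong₂ _+_ (m≥n⇒m⊓n≡n a≤s) (m≥n⇒m⊓n≡n b≤s))))

  ⊓-product-bound : ∀ {s a g h′ h m} → (s ⊓ a) * a ≤ g * h′ → s ⊓ a ≤ g → h′ ≤ h →
                    m ≤ s → m ≤ h → m * a ≤ g * h
  ⊓-product-bound {s} {a} {g} {h′} {h} {m} prod large h′≤h m≤s m≤h with ≤-total s a
  ... | inj₁ s≤a =
    ≤-trans (*-monoˡ-≤ a (subst (m ≤_) (sym (m≤n⇒m⊓n≡m s≤a)) m≤s)) (≤-trans prod (*-monoʳ-≤ g h′≤h))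
  ... | inj₂ a≤s = subst (_≤ g * h) (*-comm a m) (*-mono-≤ (subst (_≤ g) (m≥n⇒m⊓n≡n a≤s) large) m≤h)

  largest : ∀ {P : Subset n → Set} {A B} → P A → P B → ∃[ C ] P C × ∣ A ∣ ≤ ∣ C ∣ × ∣ B ∣ ≤ ∣ C ∣
  largest {A = A} {B} pA pB with ≤-total (∣ A ∣) (∣ B ∣)
  ... | inj₁ ∣A∣≤∣B∣ = B , pB , ∣A∣≤∣B∣ , ≤-refl
  ... | inj₂ ∣B∣≤∣A∣ = A , pA , ≤-refl , ∣B∣≤∣A∣

  record SparseSubsets (G H : Graph n) (s : ℕ) (S : Subset n) : Set where
    field
      Z₁ Z₂         : Subset n
      Z₁⊆S          : Z₁ ⊆ S
      Z₂⊆S          : Z₂ ⊆ S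
      Z₁-sparse     : Sparse G s Z₁
      Z₂-sparse     : Sparse H s Z₂
      Z₁-large      : s ⊓ ∣ S ∣ ≤ ∣ Z₁ ∣
      Z₂-large      : s ⊓ ∣ S ∣ ≤ ∣ Z₂ ∣
      product-large : (s ⊓ ∣ S ∣) * ∣ S ∣ ≤ ∣ Z₁ ∣ * ∣ Z₂ ∣

    swap : SparseSubsets H G s S
    swap = record
      { Z₁ = Z₂ ; Z₂ = Z₁ ; Z₁⊆S = Z₂⊆S ; Z₂⊆S = Z₁⊆S ; Z₁-sparse = Z₂-sparse ; Z₂-sparse = Z₁-sparse
      ; Z₁-large = Z₂-large ; Z₂-large = Z₁-large
      ; product-large = subst ((s ⊓ ∣ S ∣) * ∣ S ∣ ≤_) (*-comm (∣ Z₁ ∣) (∣ Z₂ ∣)) product-large }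

  module _ {G H : Graph n} {s : ℕ} where

    SparseSubsets-small : ∀ {S} → ∣ S ∣ ≤ suc s → SparseSubsets G H s S
    SparseSubsets-small {S} ∣S∣≤1+s = record
      { Z₁ = S ; Z₂ = S ; Z₁⊆S = id ; Z₂⊆S = id
      ; Z₁-sparse = small⇒Sparse G ∣S∣≤1+s ; Z₂-sparse = small⇒Sparse H ∣S∣≤1+s
      ; Z₁-large = m⊓n≤n s ∣ S ∣ ; Z₂-large = m⊓n≤n s ∣ S ∣
      ; product-large = *-monoˡ-≤ ∣ S ∣ (m⊓n≤n s ∣ S ∣) }

    SparseSubsets-∪ : ∀ {S} (sp : PureSplit G S) → Anticomplete G (PureSplit.X sp) (PureSplit.Y sp) →
      SparseSubsets G H s (PureSplit.X sp) → SparseSubsets G H s (PureSplit.Y sp) → SparseSubsets G H s S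
    SparseSubsets-∪ {S} sp anti ssX ssY = record
      { Z₁ = Z₁X ∪ Z₁Y
      ; Z₂ = Z₂
      ; Z₁⊆S = λ u∈ → [ X⊆S ∘ Z₁X⊆X , Y⊆S ∘ Z₁Y⊆Y ]′ (x∈p∪q⁻ Z₁X Z₁Y u∈)
      ; Z₂⊆S = proj₁ Z₂-candidate
      ; Z₁-sparse = Sparse-∪ G anti Z₁X⊆X Z₁Y⊆Y Z₁X-sparse Z₁Y-sparse
      ; Z₂-sparse = proj₂ Z₂-candidate
      ; Z₁-large = Z₁-large
      ; Z₂-large = Z₂-large
      ; product-large = product-large
      }
      where
      open PureSplit sp
      open ≤-Reasoning
      open SparseSubsets ssX renaming (Z₁ to Z₁X; Z₂ to Z₂X; Z₁⊆S to Z₁X⊆X; Z₂⊆S to Z₂X⊆X; Z₁-sparse to Z₁X-sparse;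
        Z₂-sparse to Z₂X-sparse; Z₁-large to Z₁X-large; Z₂-large to Z₂X-large; product-large to Z₁X-product)
      open SparseSubsets ssY renaming (Z₁ to Z₁Y; Z₂ to Z₂Y; Z₁⊆S to Z₁Y⊆Y; Z₂⊆S to Z₂Y⊆Y; Z₁-sparse to Z₁Y-sparse;
        Z₂-sparse to Z₂Y-sparse; Z₁-large to Z₁Y-large; Z₂-large to Z₂Y-large; product-large to Z₁Y-product)

      m : ℕ
      m = s ⊓ ∣ S ∣

      ∣Z₁∣ : ∣ Z₁X ∪ Z₁Y ∣ ≡ ∣ Z₁X ∣ + ∣ Z₁Y ∣
      ∣Z₁∣ = ∣p∪q∣≡∣p∣+∣q∣ λ u u∈X u∈Y → disjoint u (Z₁X⊆X u∈X) (Z₁Y⊆Y u∈Y)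

      Candidate : Subset n → Set
      Candidate Z = Z ⊆ S × Sparse H s Z

      -- Any m vertices of S are sparse in H, as m ≤ s; they keep Z₂ large.
      W : ∃[ W ] W ⊆ S × ∣ W ∣ ≡ m
      W = ⊆-with-size S (m⊓n≤n s ∣ S ∣)

      W-candidate : Candidate (proj₁ W)
      W-candidate = proj₁ (proj₂ W)
                  , small⇒Sparse H (≤-trans (≤-reflexive (proj₂ (proj₂ W))) (≤-trans (m⊓n≤m s ∣ S ∣) (n≤1+n s)))

      best-of-parts : ∃[ C ] Candidate C × ∣ Z₂X ∣ ≤ ∣ C ∣ × ∣ Z₂Y ∣ ≤ ∣ C ∣
      best-of-parts = largest {P = Candidate} (X⊆S ∘ Z₂X⊆X , Z₂X-sparse) (Y⊆S ∘ Z₂Y⊆Y , Z₂Y-sparse)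

      best : ∃[ C ] Candidate C × ∣ proj₁ best-of-parts ∣ ≤ ∣ C ∣ × ∣ proj₁ W ∣ ≤ ∣ C ∣
      best = largest {P = Candidate} (proj₁ (proj₂ best-of-parts)) W-candidate

      Z₂ : Subset n
      Z₂ = proj₁ best

      Z₂-candidate : Candidate Z₂
      Z₂-candidate = proj₁ (proj₂ best)

      ∣Z₂X∣≤ : ∣ Z₂X ∣ ≤ ∣ Z₂ ∣
      ∣Z₂X∣≤ = ≤-trans (proj₁ (proj₂ (proj₂ best-of-parts))) (proj₁ (proj₂ (proj₂ best)))

      ∣Z₂Y∣≤ : ∣ Z₂Y ∣ ≤ ∣ Z₂ ∣
      ∣Z₂Y∣≤ = ≤-trans (proj₂ (proj₂ (proj₂ best-of-parts))) (proj₁ (proj₂ (proj₂ best)))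

      Z₂-large : m ≤ ∣ Z₂ ∣
      Z₂-large = subst (_≤ ∣ Z₂ ∣) (proj₂ (proj₂ W)) (proj₂ (proj₂ (proj₂ best)))

      Z₁-large : m ≤ ∣ Z₁X ∪ Z₁Y ∣
      Z₁-large = begin
        s ⊓ ∣ S ∣                  ≡⟨ cong (s ⊓_) size ⟩
        s ⊓ (∣ X ∣ + ∣ Y ∣)         ≤⟨ ⊓-subadditive s (∣ X ∣) (∣ Y ∣) ⟩
        s ⊓ ∣ X ∣ + s ⊓ ∣ Y ∣        ≤⟨ +-mono-≤ Z₁X-large Z₁Y-large ⟩
        ∣ Z₁X ∣ + ∣ Z₁Y ∣           ≡⟨ ∣Z₁∣ ⟨
        ∣ Z₁X ∪ Z₁Y ∣              ∎

      product-large : m * ∣ S ∣ ≤ ∣ Z₁X ∪ Z₁Y ∣ * ∣ Z₂ ∣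
      product-large = begin
        m * ∣ S ∣                          ≡⟨ cong (m *_) size ⟩
        m * (∣ X ∣ + ∣ Y ∣)                 ≡⟨ *-distribˡ-+ m (∣ X ∣) (∣ Y ∣) ⟩
        m * ∣ X ∣ + m * ∣ Y ∣                ≤⟨ +-mono-≤ (⊓-product-bound Z₁X-product Z₁X-large ∣Z₂X∣≤ m≤s Z₂-large)
                                                        (⊓-product-bound Z₁Y-product Z₁Y-large ∣Z₂Y∣≤ m≤s Z₂-large) ⟩
        ∣ Z₁X ∣ * ∣ Z₂ ∣ + ∣ Z₁Y ∣ * ∣ Z₂ ∣    ≡⟨ *-distribʳ-+ (∣ Z₂ ∣) (∣ Z₁X ∣) (∣ Z₁Y ∣) ⟨
        (∣ Z₁X ∣ + ∣ Z₁Y ∣) * ∣ Z₂ ∣         ≡⟨ cong (_* ∣ Z₂ ∣) ∣Z₁∣ ⟨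
        ∣ Z₁X ∪ Z₁Y ∣ * ∣ Z₂ ∣              ∎
        where
        m≤s : m ≤ s
        m≤s = m⊓n≤m s ∣ S ∣

  sparseSubsets : (G : Graph n) → IsCograph G → (s : ℕ) (S : Subset n) → SparseSubsets G (complement G) s S
  sparseSubsets G cog s S = go S (<-wellFounded ∣ S ∣)
    where
    go : ∀ S → Acc _<_ ∣ S ∣ → SparseSubsets G (complement G) s S
    go S (acc rec) with ∣ S ∣ ≤? suc s
    ... | yes small = SparseSubsets-small small
    ... | no ¬small = from-split (cograph-split G cog (≤-<-trans (s≤s z≤n) (≰⇒> ¬small)))
      where
      from-split : PureSplit G S → SparseSubsets G (complement G) s S
      from-split sp =
        [ (λ comp → SparseSubsets.swap (SparseSubsets-∪ (PureSplit-complement sp) (Complete⇒complement-Anticomplete G comp)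
                                                          (SparseSubsets.swap ssX) (SparseSubsets.swap ssY)))
        , (λ anti → SparseSubsets-∪ sp anti ssX ssY) ]′ pure
        where
        open PureSplit sp
        ssX : SparseSubsets G (complement G) s X
        ssX = go X (rec ∣X∣<∣S∣)
        ssY : SparseSubsets G (complement G) s Y
        ssY = go Y (rec ∣Y∣<∣S∣)

  -- Peeling off pure pairs

  module _ (G : Graph n) where

    record Core : Set where
      field
        S P Q          : Subset n
        covers         : ∀ v → v ∈ S ⊎ v ∈ P ⊎ v ∈ Q
        P∩S≡∅          : Disjoint G P S
        Q∩S≡∅          : Disjoint G Q S
        P∩Q≡∅          : Disjoint G P Q
        P-complete     : Complete G P S
        Q-anticomplete : Anticomplete G Q S

      partition-size : ∣ S ∣ + (∣ P ∣ + ∣ Q ∣) ≡ n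
      partition-size = begin
        ∣ S ∣ + (∣ P ∣ + ∣ Q ∣) ≡⟨ cong (∣ S ∣ +_) (∣p∪q∣≡∣p∣+∣q∣ P∩Q≡∅) ⟨
        ∣ S ∣ + ∣ P ∪ Q ∣       ≡⟨ ∣p∪q∣≡∣p∣+∣q∣ S∩[P∪Q]≡∅ ⟨
        ∣ S ∪ (P ∪ Q) ∣         ≡⟨ cong ∣_∣ (⊆-antisym ⊆⊤ S∪P∪Q-full) ⟩
        ∣ ⊤ {n} ∣              ≡⟨ ∣⊤∣≡n n ⟩
        n                      ∎
        where
        open ≡-Reasoning
        S∩[P∪Q]≡∅ : Disjoint G S (P ∪ Q)
        S∩[P∪Q]≡∅ v v∈S v∈ = [ (λ v∈P → P∩S≡∅ v v∈P v∈S) , (λ v∈Q → Q∩S≡∅ v v∈Q v∈S) ]′ (x∈p∪q⁻ P Q v∈)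
        S∪P∪Q-full : ⊤ ⊆ S ∪ (P ∪ Q)
        S∪P∪Q-full {v} _ = [ p⊆p∪q (P ∪ Q) , q⊆p∪q S (P ∪ Q) ∘ x∈p∪q⁺ ]′ (covers v)

    whole : Core
    whole = record
      { S = ⊤ ; P = ⊥ ; Q = ⊥ ; covers = λ _ → inj₁ ∈⊤
      ; P∩S≡∅ = λ _ v∈⊥ _ → ∉⊥ v∈⊥ ; Q∩S≡∅ = λ _ v∈⊥ _ → ∉⊥ v∈⊥ ; P∩Q≡∅ = λ _ v∈⊥ _ → ∉⊥ v∈⊥
      ; P-complete = λ _ _ v∈⊥ → ⊥-elim (∉⊥ v∈⊥) ; Q-anticomplete = λ _ _ v∈⊥ → ⊥-elim (∉⊥ v∈⊥) }

    ∣P∣+∣Q∣-whole : ∣ Core.P whole ∣ + ∣ Core.Q whole ∣ ≡ 0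
    ∣P∣+∣Q∣-whole = cong₂ _+_ (∣⊥∣≡0 n) (∣⊥∣≡0 n)

    module _ (c : Core) (sp : PureSplit G (Core.S c)) where

      open Core c
      open PureSplit sp

      private
        absorb-into-Q : Anticomplete G X Y → Core
        absorb-into-Q anti = record
          { S = X ; P = P ; Q = Q ∪ Y
          ; covers = λ v → [ [ inj₁ , inj₂ ∘ inj₂ ∘ q⊆p∪q Q Y ]′ ∘ x∈p∪q⁻ X Y ∘ subst (v ∈_) S≡X∪Y
                           , [ inj₂ ∘ inj₁ , inj₂ ∘ inj₂ ∘ p⊆p∪q Y ]′ ]′ (covers v)
          ; P∩S≡∅ = λ v v∈P v∈X → P∩S≡∅ v v∈P (X⊆S v∈X)
          ; Q∩S≡∅ = λ v v∈ v∈X → [ (λ v∈Q → Q∩S≡∅ v v∈Q (X⊆S v∈X)) , disjoint v v∈X ]′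
                                 (x∈p∪q⁻ Q Y v∈)
          ; P∩Q≡∅ = λ v v∈P v∈ → [ P∩Q≡∅ v v∈P , P∩S≡∅ v v∈P ∘ Y⊆S ]′ (x∈p∪q⁻ Q Y v∈)
          ; P-complete = λ p q p∈P q∈X → P-complete p q p∈P (X⊆S q∈X)
          ; Q-anticomplete = λ p q p∈ q∈X → [ (λ p∈Q → Q-anticomplete p q p∈Q (X⊆S q∈X))
                                             , (λ p∈Y → anti q p q∈X p∈Y ∘ Adj-sym G) ]′ (x∈p∪q⁻ Q Y p∈) }

        absorb-into-P : Complete G X Y → Core
        absorb-into-P comp = record
          { S = X ; P = P ∪ Y ; Q = Q
          ; covers = λ v → [ [ inj₁ , inj₂ ∘ inj₁ ∘ q⊆p∪q P Y ]′ ∘ x∈p∪q⁻ X Y ∘ subst (v ∈_) S≡X∪Y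
                           , [ inj₂ ∘ inj₁ ∘ p⊆p∪q Y , inj₂ ∘ inj₂ ]′ ]′ (covers v)
          ; P∩S≡∅ = λ v v∈ v∈X → [ (λ v∈P → P∩S≡∅ v v∈P (X⊆S v∈X)) , disjoint v v∈X ]′
                                 (x∈p∪q⁻ P Y v∈)
          ; Q∩S≡∅ = λ v v∈Q v∈X → Q∩S≡∅ v v∈Q (X⊆S v∈X)
          ; P∩Q≡∅ = λ v v∈ v∈Q → [ (λ v∈P → P∩Q≡∅ v v∈P v∈Q) , (λ v∈Y → Q∩S≡∅ v v∈Q (Y⊆S v∈Y)) ]′
                                 (x∈p∪q⁻ P Y v∈)
          ; P-complete = λ p q p∈ q∈X → [ (λ p∈P → P-complete p q p∈P (X⊆S q∈X))
                                         , (λ p∈Y → Adj-sym G (comp q p q∈X p∈Y)) ]′ (x∈p∪q⁻ P Y p∈)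
          ; Q-anticomplete = λ p q p∈Q q∈X → Q-anticomplete p q p∈Q (X⊆S q∈X) }

        ∣Q∪Y∣ : ∣ Q ∪ Y ∣ ≡ ∣ Q ∣ + ∣ Y ∣
        ∣Q∪Y∣ = ∣p∪q∣≡∣p∣+∣q∣ λ v v∈Q → Q∩S≡∅ v v∈Q ∘ Y⊆S

        ∣P∪Y∣ : ∣ P ∪ Y ∣ ≡ ∣ P ∣ + ∣ Y ∣
        ∣P∪Y∣ = ∣p∪q∣≡∣p∣+∣q∣ λ v v∈P → P∩S≡∅ v v∈P ∘ Y⊆S

      absorb : Core
      absorb with pure
      ... | inj₁ comp = absorb-into-P comp
      ... | inj₂ anti = absorb-into-Q anti

      absorb-S : Core.S absorb ≡ X
      absorb-S with pure
      ... | inj₁ _ = refl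
      ... | inj₂ _ = refl

      absorb-size : ∣ Core.P absorb ∣ + ∣ Core.Q absorb ∣ ≡ ∣ P ∣ + ∣ Q ∣ + ∣ Y ∣
      absorb-size with pure
      ... | inj₁ _ = trans (cong (_+ ∣ Q ∣) ∣P∪Y∣) (sym (xy∙z≈xz∙y (∣ P ∣) (∣ Q ∣) (∣ Y ∣)))
      ... | inj₂ _ = trans (cong (∣ P ∣ +_) ∣Q∪Y∣) (sym (+-assoc (∣ P ∣) (∣ Q ∣) (∣ Y ∣)))

  module Descent (G : Graph n) (cog : IsCograph G)
                 (Small : ℕ → Set) (Small? : ∀ t → Dec (Small t)) (room : ∀ {t} → Small t → 2 + t ≤ n) where

    record Stop : Set where
      field
        core    : Core G
      open Core core public
      field
        small   : Small (∣ P ∣ + ∣ Q ∣)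
        split   : PureSplit G S
      open PureSplit split public
      field
        ∣Y∣≤∣X∣  : ∣ Y ∣ ≤ ∣ X ∣
        Y-too-large : ¬ Small (∣ P ∣ + ∣ Q ∣ + ∣ Y ∣)

    descend : (c : Core G) → Small (∣ Core.P c ∣ + ∣ Core.Q c ∣) → Stop
    descend c = go c (<-wellFounded ∣ Core.S c ∣)
      where
      go : ∀ c → Acc _<_ ∣ Core.S c ∣ → Small (∣ Core.P c ∣ + ∣ Core.Q c ∣) → Stop
      go c (acc rec) small = step (orient (cograph-split G cog 1<∣S∣))
        where
        open Core c
        1<∣S∣ : 1 < ∣ S ∣
        1<∣S∣ = +-cancelʳ-≤ (∣ P ∣ + ∣ Q ∣) 2 ∣ S ∣
                  (subst (2 + (∣ P ∣ + ∣ Q ∣) ≤_) (sym partition-size) (room small))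
        step : Σ (PureSplit G S) (λ sp → ∣ PureSplit.Y sp ∣ ≤ ∣ PureSplit.X sp ∣) → Stop
        step (sp , ∣Y∣≤∣X∣) with Small? (∣ P ∣ + ∣ Q ∣ + ∣ PureSplit.Y sp ∣)
        ... | no Y-too-large =
          record { core = c ; small = small ; split = sp ; ∣Y∣≤∣X∣ = ∣Y∣≤∣X∣ ; Y-too-large = Y-too-large }
        ... | yes small′ =
          go (absorb G c sp) (rec (subst (λ X → ∣ X ∣ < ∣ S ∣) (sym (absorb-S G c sp)) (PureSplit.∣X∣<∣S∣ sp)))
             (subst Small (sym (absorb-size G c sp)) small′)

  2*-<-of-scaled : ∀ {k K t n} → 2 * K * t < k * n → k ≤ K → 2 * t < n
  2*-<-of-scaled {k} {K} {t} {n} 2Kt<kn k≤K =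
    *-cancelˡ-< K (2 * t) n (<-≤-trans (subst (_< k * n) (eq K t) 2Kt<kn) (*-monoˡ-≤ n k≤K))
    where
    eq : ∀ K t → 2 * K * t ≡ K * (2 * t)
    eq = solve-∀

  2+m≤n : ∀ {m n} → 2 ≤ n → 2 * m < n → 2 + m ≤ n
  2+m≤n {zero}  2≤n _    = 2≤n
  2+m≤n {suc m} {n} _ 2m<n = begin
    2 + suc m            ≡⟨ lhs m ⟩
    suc (suc m + 1)      ≤⟨ s≤s (+-monoʳ-≤ (suc m) (s≤s z≤n)) ⟩
    suc (suc m + suc m)  ≡⟨ rhs m ⟩
    suc (2 * suc m)      ≤⟨ 2m<n ⟩
    n                    ∎
    where
    open ≤-Reasoning
    lhs : ∀ m → 2 + (1 + m) ≡ 1 + ((1 + m) + 1)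
    lhs = solve-∀
    rhs : ∀ m → 1 + ((1 + m) + (1 + m)) ≡ 1 + 2 * (1 + m)
    rhs = solve-∀

  <-of-2*<+ : ∀ {c t} → 2 * t < c + t → t < c
  <-of-2*<+ {c} {t} 2t<c+t = +-cancelʳ-< t t c (subst (_< c + t) (cong (t +_) (+-identityʳ t)) 2t<c+t)

  ≤-2*-of-2*<+ : ∀ {c t} → 2 * t < c + t → c + t ≤ 2 * c
  ≤-2*-of-2*<+ {c} {t} 2t<c+t = begin
    c + t        ≤⟨ +-monoʳ-≤ c (<⇒≤ (<-of-2*<+ 2t<c+t)) ⟩
    c + c        ≡⟨ cong (c +_) (+-identityʳ c) ⟨
    2 * c        ∎
    where open ≤-Reasoning

  scaled-≤ : ∀ {k K n x} → k ≤ K → n ≤ 4 * x → k * n ≤ 4 * K * x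
  scaled-≤ {k} {K} {n} {x} k≤K n≤4x = begin
    k * n        ≤⟨ *-mono-≤ k≤K n≤4x ⟩
    K * (4 * x)  ≡⟨ eq K x ⟩
    4 * K * x    ∎
    where
    open ≤-Reasoning
    eq : ∀ K x → K * (4 * x) ≡ 4 * K * x
    eq = solve-∀

  half-of-sum : ∀ {m K u w} → m ≤ 2 * K * (u + w) → m ≤ 4 * K * u ⊎ m ≤ 4 * K * w
  half-of-sum {m} {K} {u} {w} m≤ with ≤-total w u
  ... | inj₁ w≤u = inj₁ (≤-trans m≤ (≤-trans (*-monoʳ-≤ (2 * K) (+-monoʳ-≤ u w≤u)) (≤-reflexive (eq K u))))
    where eq : ∀ K u → 2 * K * (u + u) ≡ 4 * K * u
          eq = solve-∀
  ... | inj₂ u≤w = inj₂ (≤-trans m≤ (≤-trans (*-monoʳ-≤ (2 * K) (+-monoˡ-≤ w u≤w)) (≤-reflexive (eq K w))))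
    where eq : ∀ K w → 2 * K * (w + w) ≡ 4 * K * w
          eq = solve-∀

  -- If both failed, a²·t·c ≤ a²·g·h < t²·D² would give a²·c < t·D², and then
  -- a²·n ≤ 2a²·c < 2D²·t.
  one-large : ∀ {a D t c g h n} → t * c ≤ g * h → 2 * (D * D) * t < a * a * n → n ≤ 2 * c →
              t * D ≤ a * g ⊎ t * D ≤ a * h
  one-large {a} {D} {t} {c} {g} {h} {n} tc≤gh small n≤2c with t * D ≤? a * g | t * D ≤? a * h
  ... | yes tD≤ag | _        = inj₁ tD≤ag
  ... | no _      | yes tD≤ah = inj₂ tD≤ah
  ... | no ag<tD  | no ah<tD  = ⊥-elim (<-irrefl refl (<-≤-trans small a²n≤2D²t))
    where
    open ≤-Reasoning
    a²c<tD² : a * a * c < t * (D * D)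
    a²c<tD² = *-cancelˡ-< t _ _ (begin-strict
      t * (a * a * c)        ≡⟨ e₁ a c t ⟩
      a * a * (t * c)        ≤⟨ *-monoʳ-≤ (a * a) tc≤gh ⟩
      a * a * (g * h)        ≡⟨ e₂ a g h ⟩
      (a * g) * (a * h)      <⟨ *-mono-< (≰⇒> ag<tD) (≰⇒> ah<tD) ⟩
      (t * D) * (t * D)      ≡⟨ e₃ t D ⟩
      t * (t * (D * D))      ∎)
      where
      e₁ : ∀ a c t → t * (a * a * c) ≡ a * a * (t * c)
      e₁ = solve-∀
      e₂ : ∀ a g h → a * a * (g * h) ≡ (a * g) * (a * h)
      e₂ = solve-∀
      e₃ : ∀ t D → (t * D) * (t * D) ≡ t * (t * (D * D))
      e₃ = solve-∀
    a²n≤2D²t : a * a * n ≤ 2 * (D * D) * t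
    a²n≤2D²t = begin
      a * a * n              ≤⟨ *-monoʳ-≤ (a * a) n≤2c ⟩
      a * a * (2 * c)        ≡⟨ e₄ a c ⟩
      2 * (a * a * c)        ≤⟨ *-monoʳ-≤ 2 (<⇒≤ a²c<tD²) ⟩
      2 * (t * (D * D))      ≡⟨ e₅ t D ⟩
      2 * (D * D) * t        ∎
      where
      e₄ : ∀ a c → a * a * (2 * c) ≡ 2 * (a * a * c)
      e₄ = solve-∀
      e₅ : ∀ t D → 2 * (t * (D * D)) ≡ 2 * (D * D) * t
      e₅ = solve-∀

  -- Rationals as fractions of natural numbers

  infix 4 _≈_/1+_

  -- q ≈ a /1+ b  says  q = a / (1 + b).
  _≈_/1+_ : ℚ → ℕ → ℕ → Set
  q ≈ a /1+ b = toℚᵘ q ≃ mkℚᵘ (ℤ.+ a) b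

  ℕ→ℚ-≈ : ∀ k → ℕ→ℚ k ≈ k /1+ 0
  ℕ→ℚ-≈ k = toℚᵘ-fromℚᵘ (mkℚᵘ (ℤ.+ k) 0)

  *-≈ : ∀ {x y a b c d} → x ≈ a /1+ b → y ≈ c /1+ d → x ℚ.* y ≈ a * c /1+ (d + b * suc d)
  *-≈ {x} {y} {a} {b} {c} {d} x≈ y≈ =
    ≃-trans (toℚᵘ-homo-* x y)
            (≃-trans (*-cong x≈ y≈) (≃-reflexive (cong (λ z → mkℚᵘ z (d + b * suc d)) (sym (pos-* a c)))))

  ≤-≈ : ∀ {x y a b c d} → x ≈ a /1+ b → y ≈ c /1+ d → a * suc d ≤ c * suc b → x ℚ.≤ y
  ≤-≈ {a = a} {b} {c} {d} x≈ y≈ ad≤cb = toℚᵘ-cancel-≤ (≤-respˡ-≃ (≃-sym x≈) (≤-respʳ-≃ (≃-sym y≈)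
    (*≤* (subst₂ ℤ._≤_ (pos-* a (suc d)) (pos-* c (suc b)) (ℤ.+≤+ ad≤cb)))))

  fraction : ∀ ε → 0ℚ ℚ.< ε → ε ℚ.≤ 1ℚ → ∃[ a ] ∃[ b ] ε ≈ a /1+ b × 0 < a × a ≤ suc b
  fraction (mkℚ (ℤ.+ a) b _) 0<ε ε≤1 = a , b , ≃-refl , 0<a , a≤1+b
    where
    0<a : 0 < a
    0<a with toℚᵘ-mono-< 0<ε
    ... | *<* 0<a*1 = subst₂ _<_ refl (*-identityʳ a) (drop‿+<+ (subst₂ ℤ._<_ (sym (pos-* 0 (suc b))) (sym (pos-* a 1)) 0<a*1))
    a≤1+b : a ≤ suc b
    a≤1+b with toℚᵘ-mono-≤ ε≤1
    ... | *≤* a*1≤1+b = subst₂ _≤_ (*-identityʳ a) (*-identityˡ (suc b))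
                          (drop‿+≤+ (subst₂ ℤ._≤_ (sym (pos-* a 1)) (sym (pos-* 1 (suc b))) a*1≤1+b))
  fraction (mkℚ ℤ.-[1+ _ ] _ _) 0<ε _ with toℚᵘ-mono-< 0<ε
  ... | *<* ()

  module _ {ε : ℚ} {a b : ℕ} (ε≈ : ε ≈ a /1+ b) where

    ≤-ε* : ∀ {d m} → d * suc b ≤ a * m → ℕ→ℚ d ℚ.≤ ε ℚ.* ℕ→ℚ m
    ≤-ε* {d} {m} h =
      ≤-≈ (ℕ→ℚ-≈ d) (*-≈ ε≈ (ℕ→ℚ-≈ m)) (subst₂ _≤_ (cong (d *_) (eq b)) (sym (*-identityʳ (a * m))) h)
      where
      eq : ∀ b → 1 + b ≡ 1 + (0 + b * 1)
      eq = solve-∀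

    ε²/4*≤ : ∀ {k c} → a * a * k ≤ 4 * (suc b * suc b) * c →
             ε ℚ.* ε ℚ.* (ℤ.+ 1 ℚ./ 4) ℚ.* ℕ→ℚ k ℚ.≤ ℕ→ℚ c
    ε²/4*≤ {k} {c} h =
      ≤-≈ (*-≈ (*-≈ (*-≈ ε≈ ε≈) ≃-refl) (ℕ→ℚ-≈ k)) (ℕ→ℚ-≈ c) (subst₂ _≤_ (lhs a k) (rhs b c) h)
      where
      lhs : ∀ a k → a * a * k ≡ a * a * 1 * k * 1
      lhs = solve-∀
      rhs : ∀ b c → 4 * ((1 + b) * (1 + b)) * c ≡ c * (1 + (0 + (3 + (b + b * (1 + b)) * 4) * 1))
      rhs = solve-∀

  -- The partition

  ∈-block⁻ : ∀ {f : Fin n → Fin 4} {i v} → v ∈ block f i → f v ≡ i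
  ∈-block⁻ {f = f} {i} {v} v∈ with f v ≟ i | ∈-tabulate⁻ {f = λ u → does (f u ≟ i)} v∈
  ... | yes fv≡i | _ = fv≡i

  ∈-block⁺ : ∀ {f : Fin n → Fin 4} {i v} → f v ≡ i → v ∈ block f i
  ∈-block⁺ {f = f} {i} {v} fv≡i = ∈-tabulate⁺ {f = λ u → does (f u ≟ i)} (dec-true (f v ≟ i) fv≡i)

  block-disjoint : ∀ (G : Graph n) {f : Fin n → Fin 4} {i j} → i ≢ j → Disjoint G (block f i) (block f j)
  block-disjoint G {f} i≢j v v∈i v∈j = i≢j (trans (sym (∈-block⁻ {f = f} v∈i)) (∈-block⁻ {f = f} v∈j))

  module _ (A₀ A₁ A₂ : Subset n) where

    classify : Fin n → Fin 4
    classify v with v ∈? A₀ | v ∈? A₁ | v ∈? A₂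
    ... | yes _ | _     | _     = zero
    ... | no _  | yes _ | _     = suc zero
    ... | no _  | no _  | yes _ = suc (suc zero)
    ... | no _  | no _  | no _  = suc (suc (suc zero))

    classify-A₀ : ∀ {v} → v ∈ A₀ → classify v ≡ zero
    classify-A₀ {v} v∈ with v ∈? A₀
    ... | yes _   = refl
    ... | no v∉A₀ = ⊥-elim (v∉A₀ v∈)

    classify-zero : ∀ v → classify v ≡ zero → v ∈ A₀
    classify-zero v with v ∈? A₀ | v ∈? A₁ | v ∈? A₂
    ... | yes v∈ | _     | _     = λ _ → v∈
    ... | no _   | yes _ | _     = λ ()
    ... | no _   | no _  | yes _ = λ ()
    ... | no _   | no _  | no _  = λ ()

    classify-one : ∀ v → classify v ≡ suc zero → v ∈ A₁
    classify-one v with v ∈? A₀ | v ∈? A₁ | v ∈? A₂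
    ... | yes _ | _      | _     = λ ()
    ... | no _  | yes v∈ | _     = λ _ → v∈
    ... | no _  | no _   | yes _ = λ ()
    ... | no _  | no _   | no _  = λ ()

    classify-two : ∀ v → classify v ≡ suc (suc zero) → v ∈ A₂
    classify-two v with v ∈? A₀ | v ∈? A₁ | v ∈? A₂
    ... | yes _ | _     | _      = λ ()
    ... | no _  | yes _ | _      = λ ()
    ... | no _  | no _  | yes v∈ = λ _ → v∈
    ... | no _  | no _  | no _   = λ ()

    classify-three : ∀ {A₃} → (∀ v → v ∈ A₀ ⊎ v ∈ A₁ ⊎ v ∈ A₂ ⊎ v ∈ A₃) →
                     ∀ v → classify v ≡ suc (suc (suc zero)) → v ∈ A₃
    classify-three covers v with v ∈? A₀ | v ∈? A₁ | v ∈? A₂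
    ... | yes _  | _      | _      = λ ()
    ... | no _   | yes _  | _      = λ ()
    ... | no _   | no _   | yes _  = λ ()
    ... | no v∉₀ | no v∉₁ | no v∉₂ =
      λ _ → [ ⊥-elim ∘ v∉₀ , [ ⊥-elim ∘ v∉₁ , [ ⊥-elim ∘ v∉₂ , id ]′ ]′ ]′ (covers v)

  module Partition (G : Graph n) (cog : IsCograph G) (2≤n : 2 ≤ n) {ε : ℚ} {a b : ℕ}
                   (ε≈ : ε ≈ a /1+ b) (0<a : 0 < a) (a≤D : a ≤ suc b) where

    private
      D : ℕ
      D = suc b

    -- With ε = a / D:  Small t  is  t < ε²n/2,  and  Large c  is  c ≥ ε²n/4.
    Small : ℕ → Set
    Small t = 2 * (D * D) * t < a * a * n

    Large : ℕ → Set
    Large c = a * a * n ≤ 4 * (D * D) * c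

    private
      a²≤D² : a * a ≤ D * D
      a²≤D² = *-mono-≤ a≤D a≤D

      2t<n : ∀ {t} → Small t → 2 * t < n
      2t<n small = 2*-<-of-scaled small a²≤D²

      small-0 : Small 0
      small-0 = subst (_< a * a * n) (sym (*-zeroʳ (2 * (D * D)))) (*-mono-≤ (*-mono-≤ 0<a 0<a) (≤-trans (s≤s z≤n) 2≤n))

    Small? : ∀ t → Dec (Small t)
    Small? t = 2 * (D * D) * t <? a * a * n

    room : ∀ {t} → Small t → 2 + t ≤ n
    room small = 2+m≤n 2≤n (2t<n small)

    open Descent G cog Small Small? room public

    initial-small : Small (∣ Core.P (whole G) ∣ + ∣ Core.Q (whole G) ∣)
    initial-small = subst Small (sym (∣P∣+∣Q∣-whole G)) small-0

    module FromStop (stop : Stop) where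

      open Stop stop

      private
        t : ℕ
        t = ∣ P ∣ + ∣ Q ∣

        t<∣S∣ : t < ∣ S ∣
        t<∣S∣ = <-of-2*<+ {∣ S ∣} {t} (subst (2 * t <_) (sym partition-size) (2t<n small))

        n≤2∣S∣ : n ≤ 2 * ∣ S ∣
        n≤2∣S∣ = subst (_≤ 2 * ∣ S ∣) partition-size
                   (≤-2*-of-2*<+ {∣ S ∣} {t} (subst (2 * t <_) (sym partition-size) (2t<n small)))

        open SparseSubsets (sparseSubsets G cog t S)

        sizes : t * ∣ S ∣ ≤ ∣ Z₁ ∣ * ∣ Z₂ ∣
        sizes = subst (λ m → m * ∣ S ∣ ≤ ∣ Z₁ ∣ * ∣ Z₂ ∣) (m≤n⇒m⊓n≡m (<⇒≤ t<∣S∣)) product-large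

      record SparseSide : Set where
        field
          K                 : Graph n
          Z R₀ R₁           : Subset n
          Z⊆S               : Z ⊆ S
          Z-sparse          : Sparse K t Z
          Z-large           : t * D ≤ a * ∣ Z ∣
          S-R₀-anticomplete : Anticomplete K S R₀
          ∣R₀∣≤t            : ∣ R₀ ∣ ≤ t
          R₁∩S≡∅            : Disjoint G R₁ S
          R₁-pure           : Pure G R₁ S
          S⊎R₀⊎R₁           : ∀ v → v ∈ S ⊎ v ∈ R₀ ⊎ v ∈ R₁
          restricted        : ∀ {A} → (∀ v → v ∈ A → ℕ→ℚ (degIn K A v) ℚ.≤ ε ℚ.* ℕ→ℚ ∣ A ∣) →
                              Restricted G ε A

      side : SparseSide
      side with one-large {a} {D} {t} {∣ S ∣} {∣ Z₁ ∣} {∣ Z₂ ∣} sizes small n≤2∣S∣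
      ... | inj₁ tD≤aZ₁ = record
        { K = G ; Z = Z₁ ; R₀ = Q ; R₁ = P ; Z⊆S = Z₁⊆S ; Z-sparse = Z₁-sparse ; Z-large = tD≤aZ₁
        ; S-R₀-anticomplete = Anticomplete-sym G Q-anticomplete ; ∣R₀∣≤t = m≤n+m ∣ Q ∣ ∣ P ∣
        ; R₁∩S≡∅ = P∩S≡∅ ; R₁-pure = inj₁ P-complete
        ; S⊎R₀⊎R₁ = λ v → Data.Sum.map₂ Data.Sum.swap (covers v) ; restricted = inj₁ }
      ... | inj₂ tD≤aZ₂ = record
        { K = complement G ; Z = Z₂ ; R₀ = P ; R₁ = Q ; Z⊆S = Z₂⊆S ; Z-sparse = Z₂-sparse ; Z-large = tD≤aZ₂
        ; S-R₀-anticomplete = Anticomplete-sym (complement G) (Complete⇒complement-Anticomplete G P-complete)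
        ; ∣R₀∣≤t = m≤m+n ∣ P ∣ ∣ Q ∣
        ; R₁∩S≡∅ = Q∩S≡∅ ; R₁-pure = inj₂ Q-anticomplete
        ; S⊎R₀⊎R₁ = covers ; restricted = inj₂ }

      open SparseSide side

      private
        A₀ : Subset n
        A₀ = Z ∪ R₀

      part : Fin n → Fin 4
      part = classify A₀ R₁ Y

      private
        block₀≡A₀ : block part zero ≡ A₀
        block₀≡A₀ = ⊆-antisym (λ {v} v∈ → classify-zero A₀ R₁ Y v (∈-block⁻ {f = part} v∈))
                              (λ v∈ → ∈-block⁺ {f = part} (classify-A₀ A₀ R₁ Y v∈))

        block₁⊆R₁ : block part (suc zero) ⊆ R₁
        block₁⊆R₁ {v} v∈ = classify-one A₀ R₁ Y v (∈-block⁻ {f = part} v∈)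

        block₂⊆Y : block part (suc (suc zero)) ⊆ Y
        block₂⊆Y {v} v∈ = classify-two A₀ R₁ Y v (∈-block⁻ {f = part} v∈)

        block₃⊆X : block part (suc (suc (suc zero))) ⊆ X
        block₃⊆X {v} v∈ = classify-three A₀ R₁ Y covers′ v (∈-block⁻ {f = part} v∈)
          where
          covers′ : ∀ v → v ∈ A₀ ⊎ v ∈ R₁ ⊎ v ∈ Y ⊎ v ∈ X
          covers′ v =
            [ (λ v∈S → [ inj₂ ∘ inj₂ ∘ inj₂ , inj₂ ∘ inj₂ ∘ inj₁ ]′ (x∈p∪q⁻ X Y (subst (v ∈_) S≡X∪Y v∈S)))
            , [ inj₁ ∘ q⊆p∪q Z R₀ , inj₂ ∘ inj₁ ]′ ]′ (S⊎R₀⊎R₁ v)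

        A₀-sparse : Sparse K t A₀
        A₀-sparse = Sparse-∪ K S-R₀-anticomplete Z⊆S id Z-sparse (small⇒Sparse K (≤-trans ∣R₀∣≤t (n≤1+n t)))

      restricted₀ : Restricted G ε (block part zero)
      restricted₀ = subst (Restricted G ε) (sym block₀≡A₀) (restricted λ v v∈A₀ → ≤-ε* ε≈ {degIn K A₀ v} {∣ A₀ ∣} (degree v v∈A₀))
        where
        open ≤-Reasoning
        degree : ∀ v → v ∈ A₀ → degIn K A₀ v * D ≤ a * ∣ A₀ ∣
        degree v v∈A₀ = begin
          degIn K A₀ v * D   ≤⟨ *-monoˡ-≤ D (A₀-sparse v v∈A₀) ⟩
          t * D              ≤⟨ Z-large ⟩
          a * ∣ Z ∣          ≤⟨ *-monoʳ-≤ a (p⊆q⇒∣p∣≤∣q∣ (p⊆p∪q {p = Z} R₀)) ⟩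
          a * ∣ A₀ ∣         ∎

      pure₁₂ : PurePair G (block part (suc zero)) (block part (suc (suc zero)))
      pure₁₂ = block-disjoint G {part} (λ ()) , Pure-mono G block₁⊆R₁ (Y⊆S ∘ block₂⊆Y) R₁-pure

      pure₁₃ : PurePair G (block part (suc zero)) (block part (suc (suc (suc zero))))
      pure₁₃ = block-disjoint G {part} (λ ()) , Pure-mono G block₁⊆R₁ (X⊆S ∘ block₃⊆X) R₁-pure

      pure₂₃ : PurePair G (block part (suc (suc zero))) (block part (suc (suc (suc zero))))
      pure₂₃ = block-disjoint G {part} (λ ()) , Pure-mono G block₂⊆Y block₃⊆X (Pure-sym G pure)

      Witness : Subset n → Set
      Witness A = Σ (Subset n) λ B →
        Disjoint G B A × ε ℚ.* ε ℚ.* (ℤ.+ 1 ℚ./ 4) ℚ.* ℕ→ℚ n ℚ.≤ ℕ→ℚ ∣ B ∣ × PurePair G A B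

      private
        witness : ∀ {A C B} → A ⊆ C → Disjoint G C B → Pure G C B → Large ∣ B ∣ → Witness A
        witness {B = B} A⊆C C∩B≡∅ pure large =
          B , (λ v v∈B v∈A → C∩B≡∅ v (A⊆C v∈A) v∈B) , ε²/4*≤ ε≈ large
            , (λ v v∈A → C∩B≡∅ v (A⊆C v∈A)) , Pure-mono G A⊆C id pure

        S-large : Large ∣ S ∣
        S-large = scaled-≤ a²≤D² (≤-trans n≤2∣S∣ (*-monoˡ-≤ ∣ S ∣ (s≤s (s≤s (z≤n {2})))))

        X-large : Large ∣ X ∣
        X-large = scaled-≤ a²≤D² (begin
          n                     ≤⟨ n≤2∣S∣ ⟩
          2 * ∣ S ∣              ≡⟨ cong (2 *_) size ⟩
          2 * (∣ X ∣ + ∣ Y ∣)     ≤⟨ *-monoʳ-≤ 2 (+-monoʳ-≤ ∣ X ∣ ∣Y∣≤∣X∣) ⟩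
          2 * (∣ X ∣ + ∣ X ∣)     ≡⟨ double ∣ X ∣ ⟩
          4 * ∣ X ∣              ∎)
          where
          open ≤-Reasoning
          double : ∀ x → 2 * (x + x) ≡ 4 * x
          double = solve-∀

        -- Absorbing Y once more would leave S = X with more than ε²n/2 vertices outside,
        -- and one of the two homogeneous sides has at least half of them.
        outer-witness : Witness (block part (suc (suc (suc zero))))
        outer-witness =
          [ witness block₃⊆S′ (Disjoint-sym G P′∩S′≡∅) (Pure-sym G (inj₁ P′-complete))
          , witness block₃⊆S′ (Disjoint-sym G Q′∩S′≡∅) (Pure-sym G (inj₂ Q′-anticomplete)) ]′
          (half-of-sum {a * a * n} {D * D} {∣ P′ ∣} {∣ Q′ ∣}
            (subst (λ m → a * a * n ≤ 2 * (D * D) * m) (sym (absorb-size G core split)) (≮⇒≥ Y-too-large)))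
          where
          open Core (absorb G core split)
            renaming (S to S′; P to P′; Q to Q′; P∩S≡∅ to P′∩S′≡∅; Q∩S≡∅ to Q′∩S′≡∅;
                      P-complete to P′-complete; Q-anticomplete to Q′-anticomplete)
          block₃⊆S′ : block part (suc (suc (suc zero))) ⊆ S′
          block₃⊆S′ = subst (block part (suc (suc (suc zero))) ⊆_) (sym (absorb-S G core split)) block₃⊆X

      witnesses : ∀ i → i ≢ zero → NonEmpty G (block part i) → Witness (block part i)
      witnesses zero                   0≢0 _ = ⊥-elim (0≢0 refl)
      witnesses (suc zero)             _   _ = witness block₁⊆R₁ R₁∩S≡∅ R₁-pure S-large
      witnesses (suc (suc zero))       _   _ = witness block₂⊆Y (Disjoint-sym G disjoint) (Pure-sym G pure) X-large
      witnesses (suc (suc (suc zero))) _   _ = outer-witness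

open Cographs using (fraction; whole; module Partition)
open import Data.Nat using (ℕ; _≥_)
open import Data.Fin using (Fin; zero; suc)
open import Data.Fin.Subset using (Subset; ∣_∣)
open import Data.Rational using (ℚ; _≤_; _<_; _*_; _/_; 0ℚ; 1ℚ)
open import Data.Integer using (+_)
open import Data.Product using (Σ; _×_; _,_)
open import Relation.Binary.PropositionalEquality using (_≢_)

mainTheorem16 : ∀ {n : ℕ} (G : Graph n) → IsCograph G → n ≥ 2 →
    (ε : ℚ) → 0ℚ < ε → ε ≤ 1ℚ →
    Σ (Fin n → Fin 4) λ part →
      Restricted G ε (block part zero) ×
      PurePair G (block part (suc zero)) (block part (suc (suc zero))) ×
      PurePair G (block part (suc zero)) (block part (suc (suc (suc zero)))) ×
      PurePair G (block part (suc (suc zero))) (block part (suc (suc (suc zero)))) ×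
      (∀ (i : Fin 4) → i ≢ zero → NonEmpty G (block part i) →
        Σ (Subset n) λ B → Disjoint G B (block part i) ×
          (ε * ε * (+ 1 / 4)) * ℕ→ℚ n ≤ ℕ→ℚ ∣ B ∣ ×
          PurePair G (block part i) B)
mainTheorem16 G cog n≥2 ε 0<ε ε≤1 =
  let a , b , ε≈ , 0<a , a≤1+b = fraction ε 0<ε ε≤1
      open Partition G cog n≥2 ε≈ 0<a a≤1+b
      open FromStop (descend (whole G) initial-small)
  in part , restricted₀ , pure₁₂ , pure₁₃ , pure₂₃ , witnesses
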